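{- Let $(S,\blacktriangleleft,\sqsubset)$ be a strong continuous finitary cover and define $\blacktriangleleft_{\sqsubset}\subseteq S\times\mathcal P(S)$ by $a\blacktriangleleft_{\sqsubset}U\iff\forall b\sqsubset a\,\exists B\in\mathrm{Fin}(U)\,(b\ll_{\blacktriangleleft}B)$. (1) $(S,\blacktriangleleft_{\sqsubset})$ is a continuous basic cover with respect to the relation $\mathsf{wb}=\sqsubset$. (2) Let $\sqsubseteq$ be the reflexive closure of $\sqsubset$. Then $(S,\blacktriangleleft,\sqsubset)$ is localized if and only if $(S,\blacktriangleleft_{\sqsubset},\sqsubseteq)$ is a locally compact formal topology.
   Context: Work constructively; $\mathrm{Fin}(S)$ = finitely enumerable subsets, $\mathcal P(S)$ = subsets. A finitary cover is $(S,\blacktriangleleft)$ with $\blacktriangleleft\subseteq S\times\mathrm{Fin}(S)$ such that $a\in A\Rightarrow a\blacktriangleleft A$; $a\blacktriangleleft A\Rightarrow a\blacktriangleleft A\cup B$; $a\blacktriangleleft A\cup\{b\}\ \&\ b\blacktriangleleft A\Rightarrow a\blacktriangleleft A$. A strong continuous finitary cover is $(S,\blacktriangleleft,\sqsubset)$ with $\sqsubset$ an idempotent relation on $S$ such that $\exists b\,(a\sqsubset b\blacktriangleleft A)\iff\exists B\in\mathrm{Fin}(S)\,(a\blacktriangleleft B\ \&\ \forall b\in B\,\exists c\in A\,(b\sqsubset c))$; write $a\ll_\blacktriangleleft A\iff\exists b\,(a\sqsubset b\blacktriangleleft A)$. It is localized if $b\sqsubset a\blacktriangleleft A\Rightarrow\exists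 B\in\mathrm{Fin}(\{c\mid c\sqsubset a\ \&\ \exists a'\in A\,(c\sqsubset a')\})\,(b\blacktriangleleft B)$. A basic cover is $(S,\lhd)$ with $\lhd\subseteq S\times\mathcal P(S)$ such that $a\in U\Rightarrow a\lhd U$, and $a\lhd U$ together with $U\lhd V$ (i.e. $\forall u\in U\,(u\lhd V)$) implies $a\lhd V$. It is continuous with respect to $\mathsf{wb}\subseteq S\times S$ if $a\lhd\{b\mid b\,\mathsf{wb}\,a\}$ for all $a$, and $b\,\mathsf{wb}\,a\ \&\ a\lhd U\Rightarrow\exists A\in\mathrm{Fin}(U)\,(b\lhd A)$. A formal topology is $(S,\lhd,\le)$ with $(S,\lhd)$ a basic cover and $\le$ a preorder such that $a\le b\Rightarrow a\lhd\{b\}$, and $a\lhd U\ \&\ a\lhd V\Rightarrow a\lhd(\downarrow_\le U\cap\downarrow_\le V)$ where $\downarrow_\le U=\{c\mid\exists u\in U\,(c\le u)\}$. It is locally compact if $(S,\lhd)$ is continuous (for some such $\mathsf{wb}$). -}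

module Defs where

open import Level using (0ℓ)
open import Data.Product using (Σ; ∃; ∃-syntax; _×_; _,_)
open import Data.Sum using (_⊎_)
open import Data.List using (List; []; _∷_)
open import Data.List.Membership.Propositional using (_∈_)
open import Data.List.Relation.Binary.Subset.Propositional using (_⊆_)
open import Data.List.Relation.Unary.All using (All)
open import Data.List.Relation.Unary.Any using (Any)
open import Relation.Binary.PropositionalEquality using (_≡_)
open import Function.Bundles using (_⇔_)

-- Subsets P(S) are predicates S → Set; finitely enumerable subsets Fin(S)
-- are represented by lists enumerating them.  "B ∈ Fin(U)" = a list all
-- of whose entries lie in U.

FinOf : {S : Set} → (S → Set) → List S → Set
FinOf U B = All U B

⟦_⟧ : {S : Set} → List S → S → Set
⟦ A ⟧ x = x ∈ A

-- Finitary covers  ◀ ⊆ S × Fin(S)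
-- Since Fin(S) consists of *sets*, ◀ must not depend on the enumeration;
-- the weakening axiom is stated for any list C enumerating a superset of A
-- (C represents A ∪ C), which also yields invariance under re-enumeration.
-- The cut axiom uses the representative  b ∷ A  of  A ∪ {b}.

record IsFinitaryCover {S : Set} (_◀_ : S → List S → Set) : Set where
  field
    reflexivity : ∀ {a A} → a ∈ A → a ◀ A
    weakening   : ∀ {a A C} → a ◀ A → A ⊆ C → a ◀ C
    cut         : ∀ {a b A} → a ◀ (b ∷ A) → b ◀ A → a ◀ A

Idempotent : {S : Set} → (S → S → Set) → Set
Idempotent {S} _⊏_ = ∀ a c → (a ⊏ c) ⇔ (∃[ b ] (a ⊏ b × b ⊏ c))

WayBelow : {S : Set} → (S → List S → Set) → (S → S → Set) → S → List S → Set
WayBelow _◀_ _⊏_ a A = ∃[ b ] (a ⊏ b × b ◀ A)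

record IsStrongContinuousFinitaryCover {S : Set}
    (_◀_ : S → List S → Set) (_⊏_ : S → S → Set) : Set where
  field
    finitaryCover : IsFinitaryCover _◀_
    idempotent    : Idempotent _⊏_
    strong        : ∀ a A →
      (∃[ b ] (a ⊏ b × b ◀ A)) ⇔
      (∃[ B ] (a ◀ B × All (λ b → ∃[ c ] (c ∈ A × b ⊏ c)) B))

IsLocalized : {S : Set} → (S → List S → Set) → (S → S → Set) → Set
IsLocalized {S} _◀_ _⊏_ =
  ∀ a b A → b ⊏ a → a ◀ A →
    ∃[ B ] (FinOf (λ c → c ⊏ a × ∃[ a' ] (a' ∈ A × c ⊏ a')) B × b ◀ B)

Cover⊏ : {S : Set} → (S → List S → Set) → (S → S → Set) → S → (S → Set) → Set
Cover⊏ _◀_ _⊏_ a U = ∀ b → b ⊏ a → ∃[ B ] (FinOf U B × WayBelow _◀_ _⊏_ b B)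

ReflClosure : {S : Set} → (S → S → Set) → S → S → Set
ReflClosure _⊏_ a b = a ≡ b ⊎ a ⊏ b

record IsBasicCover {S : Set} (_◁_ : S → (S → Set) → Set) : Set₁ where
  field
    reflexivity  : ∀ {a} {U : S → Set} → U a → a ◁ U
    transitivity : ∀ {a} {U V : S → Set} → a ◁ U → (∀ u → U u → u ◁ V) → a ◁ V

record IsContinuousWrt {S : Set} (_◁_ : S → (S → Set) → Set)
    (wb : S → S → Set) : Set₁ where
  field
    approx  : ∀ a → a ◁ (λ b → wb b a)
    compact : ∀ {a b} {U : S → Set} → wb b a → a ◁ U →
              ∃[ A ] (FinOf U A × b ◁ ⟦ A ⟧)

record IsContinuousBasicCover {S : Set} (_◁_ : S → (S → Set) → Set)
    (wb : S → S → Set) : Set₁ where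
  field
    basicCover : IsBasicCover _◁_
    continuous : IsContinuousWrt _◁_ wb

↓_⟨_⟩ : {S : Set} → (S → S → Set) → (S → Set) → S → Set
↓ _≤_ ⟨ U ⟩ c = ∃[ u ] (U u × c ≤ u)

record IsFormalTopology {S : Set} (_◁_ : S → (S → Set) → Set)
    (_≤_ : S → S → Set) : Set₁ where
  field
    basicCover : IsBasicCover _◁_
    ≤-refl     : ∀ a → a ≤ a
    ≤-trans    : ∀ {a b c} → a ≤ b → b ≤ c → a ≤ c
    ≤⇒◁        : ∀ {a b} → a ≤ b → a ◁ (λ x → x ≡ b)
    meet       : ∀ {a} {U V : S → Set} → a ◁ U → a ◁ V →
                 a ◁ (λ c → ↓ _≤_ ⟨ U ⟩ c × ↓ _≤_ ⟨ V ⟩ c)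

record IsLocallyCompactFormalTopology {S : Set} (_◁_ : S → (S → Set) → Set)
    (_≤_ : S → S → Set) : Set₁ where
  field
    formalTopology : IsFormalTopology _◁_ _≤_
    wb             : S → S → Set
    continuous     : IsContinuousWrt _◁_ wb

-- Strong continuity lets one pass between  a ≪ A  and  a ◀ B  with B refining A along ⊏;
-- transitivity of ◀⊏ then comes from the cut rule, continuity from interpolation.
-- Localization is exactly what makes ◀⊏ satisfy  a ◀⊏ U ⇒ a ◀⊏ {c ⊏ a | c ⊏ some u ∈ U},
-- and two applications of this give the meet rule; conversely the meet of
-- a ◀⊏ {c | c ⊏ a} with a ◀⊏ A is the localization of a ◀ A.
module Submission where

open import Defs
open import Data.List using (List; []; _∷_; _++_)
open import Data.List.Membership.Propositional using (_∈_)
open import Data.List.Membership.Propositional.Properties using (∈-++⁺ˡ; ∈-++⁺ʳ)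
open import Data.List.Relation.Unary.All as All using (All; []; _∷_; lookup)
open import Data.List.Relation.Unary.All.Properties using (++⁺)
open import Data.List.Relation.Unary.Any using (here; there)
open import Data.Product using (_×_; _,_; ∃-syntax)
open import Data.Sum using (inj₁; inj₂)
open import Function.Bundles using (_⇔_; mk⇔; Equivalence)
open import Relation.Binary.PropositionalEquality using (_≡_; refl)

witnesses : {S : Set} {R : S → S → Set} {P : S → Set} {X : List S} →
  All (λ x → ∃[ c ] (R x c × P c)) X →
  ∃[ Y ] (All P Y × All (λ x → ∃[ c ] (c ∈ Y × R x c)) X)
witnesses [] = [] , [] , []
witnesses ((c , r , p) ∷ rest) with witnesses rest
... | Y , pY , rY = c ∷ Y , p ∷ pY ,
      (c , here refl , r) ∷ All.map (λ { (c' , c'∈Y , r') → c' , there c'∈Y , r' }) rY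

module FinitaryCoverProperties {S : Set} {_◀_ : S → List S → Set}
    (isFinitaryCover : IsFinitaryCover _◀_) where
  open IsFinitaryCover isFinitaryCover

  cut-all : ∀ {a} X {C} → a ◀ (X ++ C) → All (_◀ C) X → a ◀ C
  cut-all []      a◀C   []          = a◀C
  cut-all (x ∷ X) a◀xXC (x◀C ∷ X◀C) = cut-all X (cut a◀xXC (weakening x◀C (∈-++⁺ʳ X))) X◀C

  common-cover : {W : S → Set} {X : List S} → All (λ x → ∃[ E ] (All W E × x ◀ E)) X →
    ∃[ F ] (All W F × All (_◀ F) X)
  common-cover [] = [] , [] , []
  common-cover ((E , WE , x◀E) ∷ rest) with common-cover rest
  ... | F , WF , X◀F = E ++ F , ++⁺ WE WF ,
        weakening x◀E ∈-++⁺ˡ ∷ All.map (λ y◀F → weakening y◀F (∈-++⁺ʳ E)) X◀F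

  ◀-trans : {W : S → Set} {a : S} {X : List S} → a ◀ X →
    All (λ x → ∃[ E ] (All W E × x ◀ E)) X → ∃[ F ] (All W F × a ◀ F)
  ◀-trans {X = X} a◀X covers with common-cover covers
  ... | F , WF , X◀F = F , WF , cut-all X (weakening a◀X ∈-++⁺ˡ) X◀F

module StrongContinuousFinitaryCoverProperties {S : Set}
    {_◀_ : S → List S → Set} {_⊏_ : S → S → Set}
    (H : IsStrongContinuousFinitaryCover _◀_ _⊏_) where
  open IsStrongContinuousFinitaryCover H
  open IsFinitaryCover finitaryCover using (reflexivity)
  open FinitaryCoverProperties finitaryCover using (◀-trans)

  _≪_ : S → List S → Set
  _≪_ = WayBelow _◀_ _⊏_

  _⊏*_ : List S → List S → Set
  B ⊏* A = All (λ b → ∃[ c ] (c ∈ A × b ⊏ c)) B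

  _≤_ : S → S → Set
  _≤_ = ReflClosure _⊏_

  _◁_ : S → (S → Set) → Set
  _◁_ = Cover⊏ _◀_ _⊏_

  ⊏-trans : ∀ {a b c} → a ⊏ b → b ⊏ c → a ⊏ c
  ⊏-trans {a} {b} {c} a⊏b b⊏c = Equivalence.from (idempotent a c) (b , a⊏b , b⊏c)

  ⊏-interpolate : ∀ {a c} → a ⊏ c → ∃[ b ] (a ⊏ b × b ⊏ c)
  ⊏-interpolate {a} {c} = Equivalence.to (idempotent a c)

  ⊏-≤-trans : ∀ {a b c} → a ⊏ b → b ≤ c → a ⊏ c
  ⊏-≤-trans a⊏b (inj₁ refl) = a⊏b
  ⊏-≤-trans a⊏b (inj₂ b⊏c) = ⊏-trans a⊏b b⊏c

  ≤-⊏-trans : ∀ {a b c} → a ≤ b → b ⊏ c → a ⊏ c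
  ≤-⊏-trans (inj₁ refl) b⊏c = b⊏c
  ≤-⊏-trans (inj₂ a⊏b) b⊏c = ⊏-trans a⊏b b⊏c

  ≤-trans : ∀ {a b c} → a ≤ b → b ≤ c → a ≤ c
  ≤-trans (inj₁ refl) b≤c = b≤c
  ≤-trans (inj₂ a⊏b) b≤c = inj₂ (⊏-≤-trans a⊏b b≤c)

  ≪⇒◀-⊏* : ∀ {a A} → a ≪ A → ∃[ B ] (a ◀ B × B ⊏* A)
  ≪⇒◀-⊏* {a} {A} = Equivalence.to (strong a A)

  ◀-⊏*⇒≪ : ∀ {a A B} → a ◀ B → B ⊏* A → a ≪ A
  ◀-⊏*⇒≪ {a} {A} {B} a◀B B⊏*A = Equivalence.from (strong a A) (B , a◀B , B⊏*A)

  ⊏-≪-trans : ∀ {a b A} → a ⊏ b → b ≪ A → a ≪ A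
  ⊏-≪-trans a⊏b (c , b⊏c , c◀A) = c , ⊏-trans a⊏b b⊏c , c◀A

  ◀-≪-trans : {W : S → Set} {a : S} {X : List S} → a ◀ X →
    All (λ x → ∃[ C ] (All W C × x ≪ C)) X → ∃[ F ] (All W F × a ≪ F)
  ◀-≪-trans {W = W} a◀X X≪W with witnesses (All.map unfold X≪W)
    where
    unfold : ∀ {x} → ∃[ C ] (All W C × x ≪ C) → ∃[ c ] (x ⊏ c × ∃[ C ] (All W C × c ◀ C))
    unfold (C , WC , c , x⊏c , c◀C) = c , x⊏c , C , WC , c◀C
  ... | Y , Y◀W , X⊏*Y with ◀-⊏*⇒≪ a◀X X⊏*Y
  ... | z , a⊏z , z◀Y with ◀-trans z◀Y Y◀W
  ... | F , WF , z◀F = F , WF , z , a⊏z , z◀F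

  ◁-refl : ∀ {a} {U : S → Set} → U a → a ◁ U
  ◁-refl {a} Ua b b⊏a = a ∷ [] , Ua ∷ [] , a , b⊏a , reflexivity (here refl)

  ◁-trans : ∀ {a} {U V : S → Set} → a ◁ U → (∀ u → U u → u ◁ V) → a ◁ V
  ◁-trans {U = U} {V} a◁U U◁V b b⊏a with a◁U b b⊏a
  ... | B , UB , b≪B with ≪⇒◀-⊏* b≪B
  ... | X , b◀X , X⊏*B = ◀-≪-trans b◀X (All.map below-V X⊏*B)
    where
    below-V : ∀ {x} → ∃[ u ] (u ∈ B × x ⊏ u) → ∃[ C ] (All V C × x ≪ C)
    below-V (u , u∈B , x⊏u) = U◁V u (lookup UB u∈B) _ x⊏u

  ◁-mono : ∀ {a} {U V : S → Set} → a ◁ U → (∀ x → U x → V x) → a ◁ V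
  ◁-mono a◁U U⊆V b b⊏a with a◁U b b⊏a
  ... | B , UB , b≪B = B , All.map (U⊆V _) UB , b≪B

  ⊏-◁-trans : ∀ {a c} {U : S → Set} → c ⊏ a → a ◁ U → c ◁ U
  ⊏-◁-trans c⊏a a◁U b b⊏c = a◁U b (⊏-trans b⊏c c⊏a)

  ◀⇒◁ : ∀ {a A} → a ◀ A → a ◁ ⟦ A ⟧
  ◀⇒◁ {a} {A} a◀A b b⊏a = A , All.tabulate (λ x∈A → x∈A) , a , b⊏a , a◀A

  ≪⇒◁ : ∀ {a A} → a ≪ A → a ◁ ⟦ A ⟧
  ≪⇒◁ (c , a⊏c , c◀A) = ⊏-◁-trans a⊏c (◀⇒◁ c◀A)

  ◁-approx : ∀ a → a ◁ (_⊏ a)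
  ◁-approx a b b⊏a with ⊏-interpolate b⊏a
  ... | m , b⊏m , m⊏a = ◁-refl m⊏a b b⊏m

  ◁-compact : ∀ {a b} {U : S → Set} → b ⊏ a → a ◁ U → ∃[ A ] (FinOf U A × b ◁ ⟦ A ⟧)
  ◁-compact b⊏a a◁U with a◁U _ b⊏a
  ... | A , UA , b≪A = A , UA , ≪⇒◁ b≪A

  ≤⇒◁ : ∀ {a b} → a ≤ b → a ◁ (_≡ b)
  ≤⇒◁ (inj₁ refl) = ◁-refl refl
  ≤⇒◁ (inj₂ a⊏b) = ⊏-◁-trans a⊏b (◁-refl refl)

  isContinuousBasicCover : IsContinuousBasicCover _◁_ _⊏_
  isContinuousBasicCover = record
    { basicCover = record { reflexivity = ◁-refl ; transitivity = ◁-trans }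
    ; continuous = record { approx = ◁-approx ; compact = ◁-compact }
    }

  module _ (localized : IsLocalized _◀_ _⊏_) where

    ≪-localize : ∀ {x d B} → x ⊏ d → d ≪ B →
      ∃[ E ] (All (λ e → e ⊏ d × ∃[ c ] (c ∈ B × e ⊏ c)) E × x ◀ E)
    ≪-localize {x} {d} {B} x⊏d d≪B with ≪⇒◀-⊏* d≪B
    ... | G , d◀G , G⊏*B with localized d x G x⊏d d◀G
    ... | E , E-below , x◀E = E , All.map refine E-below , x◀E
      where
      refine : ∀ {e} → e ⊏ d × ∃[ g ] (g ∈ G × e ⊏ g) → e ⊏ d × ∃[ c ] (c ∈ B × e ⊏ c)
      refine (e⊏d , g , g∈G , e⊏g) with lookup G⊏*B g∈G
      ... | c , c∈B , g⊏c = e⊏d , c , c∈B , ⊏-trans e⊏g g⊏c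

    ◁-localize : ∀ {a} {U : S → Set} → a ◁ U → a ◁ (λ c → c ⊏ a × ↓ _⊏_ ⟨ U ⟩ c)
    ◁-localize {a} {U} a◁U b b⊏a with ⊏-interpolate b⊏a
    ... | z , b⊏z , z⊏a with ⊏-interpolate z⊏a
    ... | p , z⊏p , p⊏a with a◁U p p⊏a
    ... | B , UB , p≪B with ≪-localize z⊏p p≪B
    ... | E , E-below , z◀E = E , All.map below-a E-below , z , b⊏z , z◀E
      where
      below-a : ∀ {e} → e ⊏ p × ∃[ c ] (c ∈ B × e ⊏ c) → e ⊏ a × ↓ _⊏_ ⟨ U ⟩ e
      below-a (e⊏p , c , c∈B , e⊏c) = ⊏-trans e⊏p p⊏a , c , lookup UB c∈B , e⊏c

    ◁-meet : ∀ {a} {U V : S → Set} → a ◁ U → a ◁ V →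
      a ◁ (λ c → ↓ _≤_ ⟨ U ⟩ c × ↓ _≤_ ⟨ V ⟩ c)
    ◁-meet a◁U a◁V = ◁-trans (◁-localize a◁U) λ c (c⊏a , u , Uu , c⊏u) →
      ◁-mono (◁-localize (⊏-◁-trans c⊏a a◁V)) λ e (e⊏c , v , Vv , e⊏v) →
        (u , Uu , inj₂ (⊏-trans e⊏c c⊏u)) , (v , Vv , inj₂ e⊏v)

    isLocallyCompactFormalTopology : IsLocallyCompactFormalTopology _◁_ _≤_
    isLocallyCompactFormalTopology = record
      { formalTopology = record
        { basicCover = IsContinuousBasicCover.basicCover isContinuousBasicCover
        ; ≤-refl = λ _ → inj₁ refl
        ; ≤-trans = ≤-trans
        ; ≤⇒◁ = ≤⇒◁
        ; meet = ◁-meet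
        }
      ; wb = _⊏_
      ; continuous = IsContinuousBasicCover.continuous isContinuousBasicCover
      }

  meet⇒localized :
    (∀ {a} {U V : S → Set} → a ◁ U → a ◁ V → a ◁ (λ c → ↓ _≤_ ⟨ U ⟩ c × ↓ _≤_ ⟨ V ⟩ c)) →
    IsLocalized _◀_ _⊏_
  meet⇒localized meet a b A b⊏a a◀A with meet (◁-approx a) (◀⇒◁ a◀A) b b⊏a
  ... | F , F-below , b≪F with ≪⇒◀-⊏* b≪F
  ... | B , b◀B , B⊏*F = B , All.map below-a-and-A B⊏*F , b◀B
    where
    below-a-and-A : ∀ {g} → ∃[ c ] (c ∈ F × g ⊏ c) → g ⊏ a × ∃[ a' ] (a' ∈ A × g ⊏ a')
    below-a-and-A (c , c∈F , g⊏c) with lookup F-below c∈F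
    ... | (y , y⊏a , c≤y) , (a' , a'∈A , c≤a') =
      ⊏-trans g⊏c (≤-⊏-trans c≤y y⊏a) , a' , a'∈A , ⊏-≤-trans g⊏c c≤a'

proposition4p32 : (S : Set) (_◀_ : S → List S → Set) (_⊏_ : S → S → Set) →
    IsStrongContinuousFinitaryCover _◀_ _⊏_ →
    IsContinuousBasicCover (Cover⊏ _◀_ _⊏_) _⊏_
    × (IsLocalized _◀_ _⊏_ ⇔ IsLocallyCompactFormalTopology (Cover⊏ _◀_ _⊏_) (ReflClosure _⊏_))
proposition4p32 S _◀_ _⊏_ H =
  isContinuousBasicCover ,
  mk⇔ isLocallyCompactFormalTopology
      (λ lc → meet⇒localized (IsFormalTopology.meet (IsLocallyCompactFormalTopology.formalTopology lc)))
  where open StrongContinuousFinitaryCoverProperties H
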